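{- A graph $G$ is a proper Helly circular-arc graph if and only if its clique-matrix $Q(G)$ has the circular-ones property for rows.
   Context: A circular-arc model of a graph is a set of arcs on a circle whose intersection graph is the graph; it is proper if no arc is a proper subset of another, and Helly if every nonempty subfamily of pairwise intersecting arcs has nonempty common intersection. A proper Helly circular-arc graph is a graph admitting a circular-arc model that is simultaneously proper and Helly. The clique-matrix $Q(G)$ is the incidence matrix of inclusion-wise maximal cliques (rows) versus vertices (columns); it is unique up to row and column permutations. A binary matrix has the circular-ones property for rows if its columns can be circularly arranged so that the $1$'s of each row occur consecutively. -}

module Defs where

open import Data.Nat using (ℕ; zero; suc; _+_; _∸_; _<_; _≤_)
open import Data.Nat.DivMod using (_%_)
open import Data.Fin using (Fin; toℕ)
open import Data.Fin.Permutation using (Permutation′; _⟨$⟩ˡ_)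
open import Data.Bool using (Bool; true; false)
open import Data.Product using (Σ; ∃; _×_; ∃-syntax; Σ-syntax)
open import Data.Sum using (_⊎_)
open import Data.Unit using (⊤)
open import Relation.Nullary using (¬_)
open import Relation.Binary.PropositionalEquality using (_≡_; _≢_)
open import Function.Bundles using (_⇔_)

record SimpleGraph (n : ℕ) : Set where
  field
    Adj    : Fin n → Fin n → Bool
    sym    : ∀ u v → Adj u v ≡ Adj v u
    irrefl : ∀ u → Adj u u ≡ false
open SimpleGraph public

VSet : ℕ → Set
VSet n = Fin n → Bool

_∈ₛ_ : ∀ {n} → Fin n → VSet n → Set
v ∈ₛ S = S v ≡ true

_⊆ₛ_ : ∀ {n} → VSet n → VSet n → Set
S ⊆ₛ T = ∀ v → v ∈ₛ S → v ∈ₛ T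

IsClique : ∀ {n} → SimpleGraph n → VSet n → Set
IsClique G S = ∀ u v → u ∈ₛ S → v ∈ₛ S → u ≢ v → Adj G u v ≡ true

IsMaxClique : ∀ {n} → SimpleGraph n → VSet n → Set
IsMaxClique G S = IsClique G S × (∀ T → IsClique G T → S ⊆ₛ T → T ⊆ₛ S)

-- Discrete circle with points Fin (suc c), in circular order 0,1,…,c,0.
-- Circular offset of p from s: (p - s) mod (suc c).

offset : ∀ c → Fin (suc c) → Fin (suc c) → ℕ
offset c s p = (toℕ p + (suc c ∸ toℕ s)) % suc c

InCircInt : ∀ c → Fin (suc c) → ℕ → Fin (suc c) → Set
InCircInt c s l p = offset c s p < l

record Arc (c : ℕ) : Set where
  constructor arc
  field
    start  : Fin (suc c)
    len    : ℕ
    len≥1  : 1 ≤ len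
    len≤   : len ≤ suc c
open Arc public

_∈A_ : ∀ {c} → Fin (suc c) → Arc c → Set
_∈A_ {c} p A = InCircInt c (start A) (len A) p

Intersect : ∀ {c} → Arc c → Arc c → Set
Intersect A B = ∃[ p ] (p ∈A A × p ∈A B)

ProperSubArc : ∀ {c} → Arc c → Arc c → Set
ProperSubArc A B = (∀ p → p ∈A A → p ∈A B) × (∃[ p ] (p ∈A B × ¬ (p ∈A A)))

IsCAModel : ∀ {n c} → SimpleGraph n → (Fin n → Arc c) → Set
IsCAModel G A = ∀ u v → u ≢ v → (Adj G u v ≡ true) ⇔ Intersect (A u) (A v)

IsProperModel : ∀ {n c} → (Fin n → Arc c) → Set
IsProperModel A = ∀ u v → ¬ ProperSubArc (A u) (A v)

IsHellyModel : ∀ {n c} → (Fin n → Arc c) → Set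
IsHellyModel {n} {c} A =
  ∀ (S : VSet n) → (∃[ v ] v ∈ₛ S) →
  (∀ u v → u ∈ₛ S → v ∈ₛ S → Intersect (A u) (A v)) →
  ∃[ p ] (∀ v → v ∈ₛ S → p ∈A A v)

IsProperHellyCA : ∀ {n} → SimpleGraph n → Set
IsProperHellyCA {n} G =
  ∃[ c ] Σ[ A ∈ (Fin n → Arc c) ] (IsCAModel G A × IsProperModel A × IsHellyModel A)

BMatrix : ℕ → ℕ → Set
BMatrix k n = Fin k → Fin n → Bool

CircConsecutive : ∀ n → (Fin n → Bool) → Set
CircConsecutive zero    R = ⊤
CircConsecutive (suc m) R =
  Σ[ s ∈ Fin (suc m) ] Σ[ l ∈ ℕ ] (l ≤ suc m × (∀ q → (R q ≡ true) ⇔ InCircInt m s l q))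

-- columns circularly arranged by π (column j placed at position π j)
-- so that every row has consecutive 1's
CircularOnesRows : ∀ {k n} → BMatrix k n → Set
CircularOnesRows {k} {n} Q =
  Σ[ π ∈ Permutation′ n ] (∀ i → CircConsecutive n (λ q → Q i (π ⟨$⟩ˡ q)))

IsCliqueMatrix : ∀ {n} → SimpleGraph n → ∀ {k} → BMatrix k n → Set
IsCliqueMatrix {n} G {k} Q =
    (∀ i → IsMaxClique G (Q i))
  × (∀ i j → (∀ v → Q i v ≡ Q j v) → i ≡ j)
  × (∀ S → IsMaxClique G S → ∃[ i ] (∀ v → Q i v ≡ S v))

module Submission where

-- Order the vertices by the start points of
-- their arcs.  By the Helly property the arcs of a maximal clique share a
-- point x, and by maximality the clique consists of all arcs through x.  Let w
-- be the arc through x starting farthest before x; by properness an arc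
-- contains x exactly when its start lies between the start of w and x, so
-- every row of Q is a circular interval of the start order.
--
-- Put the vertices on a circle in the given
-- order and let the reach of a position p be the largest j < n such that the
-- positions p, …, p + j are pairwise adjacent.  Every edge lies in a row, every
-- row is a circular interval, and inside it the earlier of two positions
-- reaches the later one; hence the arcs [p, p + reach p] form a model, and the
-- last position of a row is a common point of the arcs of its vertices, which
-- gives the Helly property.  To make the model proper the circle is refined
-- into n blocks of n points and the arc of p stops reach p points before the
-- end of block p + reach p: of two arcs ending in the same block, the one
-- starting earlier has the larger reach and so ends earlier.

open import Defs renaming (sym to Adj-sym)
open import Data.Nat hiding (_≟_)
open import Data.Nat.Properties hiding (_≟_)
open import Data.Nat.DivMod
open import Data.Nat.Tactic.RingSolver using (solve-∀)
open import Data.Bool using (Bool; true; false)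
open import Data.Bool.Properties using () renaming (_≟_ to _≟ᵇ_)
open import Data.Empty using (⊥-elim)
open import Data.Fin using (Fin; zero; suc; toℕ; fromℕ<; punchOut; _≟_)
open import Data.Fin.Properties
  using (all?; any?; toℕ<n; toℕ-fromℕ<; toℕ-injective; fromℕ<-injective; punchOut-injective; injective⇒≤)
import Data.Fin.Properties as Fin
open import Data.Fin.Permutation
  using (Permutation′; permutation; _⟨$⟩ʳ_; _⟨$⟩ˡ_; inverseˡ; inverseʳ) renaming (id to idₚ)
open import Data.List using (List; []; _∷_; allFin)
open import Data.List.Membership.Propositional using (_∈_)
open import Data.List.Membership.Propositional.Properties using (∈-allFin)
open import Data.List.Relation.Unary.Any using (here; there)
open import Data.Product using (_×_; _,_; proj₁; proj₂; map₂; swap; ∃-syntax)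
open import Data.Product.Function.NonDependent.Propositional using (_×-⇔_)
open import Data.Product.Relation.Binary.Lex.Strict using (×-strictTotalOrder)
open import Data.Sum using (_⊎_; inj₁; inj₂; [_,_]′)
open import Data.Sum.Function.Propositional using (_⊎-⇔_)
open import Data.Unit using (tt)
open import Function using (_∘_)
open import Function.Bundles using (_⇔_; mk⇔; Equivalence)
open import Function.Definitions using (Injective)
open import Function.Properties.Equivalence using () renaming (trans to ⇔-trans; sym to ⇔-sym)
open import Relation.Binary using (StrictTotalOrder; tri<; tri≈; tri>)
open import Relation.Binary.PropositionalEquality
open import Relation.Nullary using (¬_; Dec; yes; no; does)
open import Relation.Nullary.Decidable using (_×-dec_; _→-dec_; ¬?; dec-true)
open import Relation.Unary using (Decidable)

-- Bounded search and counting

record Greatest (P : ℕ → Set) (b : ℕ) : Set where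
  field
    value    : ℕ
    value≤   : value ≤ b
    holds    : P value
    maximal  : ∀ {j} → j ≤ b → P j → j ≤ value

greatest : ∀ {P : ℕ → Set} → Decidable P → P 0 → ∀ b → Greatest P b
greatest P? P0 zero = record { value = 0 ; value≤ = z≤n ; holds = P0 ; maximal = λ j≤0 _ → j≤0 }
greatest {P} P? P0 (suc b) with P? (suc b)
... | yes Pb = record { value = suc b ; value≤ = ≤-refl ; holds = Pb ; maximal = λ j≤ _ → j≤ }
... | no ¬Pb = record { value = value ; value≤ = m≤n⇒m≤1+n value≤ ; holds = holds ; maximal = maximal′ }
  where
  open Greatest (greatest P? P0 b)
  maximal′ : ∀ {j} → j ≤ suc b → P j → j ≤ value
  maximal′ {j} j≤ Pj with m≤n⇒m<n∨m≡n j≤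
  ... | inj₁ j<sb = maximal (s≤s⁻¹ j<sb) Pj
  ... | inj₂ refl = ⊥-elim (¬Pb Pj)

count : ∀ {n} {P : Fin n → Set} → Decidable P → ℕ
count {zero}  P? = 0
count {suc n} P? with P? zero
... | yes _ = suc (count (P? ∘ suc))
... | no _  = count (P? ∘ suc)

count-mono : ∀ {n} {P Q : Fin n → Set} (P? : Decidable P) (Q? : Decidable Q) →
  (∀ u → P u → Q u) → count P? ≤ count Q?
count-mono {zero}  P? Q? P⊆Q = z≤n
count-mono {suc n} P? Q? P⊆Q with P? zero | Q? zero
... | yes P0 | no ¬Q0 = ⊥-elim (¬Q0 (P⊆Q zero P0))
... | yes _  | yes _  = s≤s (count-mono (P? ∘ suc) (Q? ∘ suc) (P⊆Q ∘ suc))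
... | no _   | yes _  = m≤n⇒m≤1+n (count-mono (P? ∘ suc) (Q? ∘ suc) (P⊆Q ∘ suc))
... | no _   | no _   = count-mono (P? ∘ suc) (Q? ∘ suc) (P⊆Q ∘ suc)

count-strict : ∀ {n} {P Q : Fin n → Set} (P? : Decidable P) (Q? : Decidable Q) →
  (∀ u → P u → Q u) → ∀ w → Q w → ¬ P w → count P? < count Q?
count-strict {suc n} P? Q? P⊆Q w Qw ¬Pw with P? zero | Q? zero | w
... | yes P0 | no ¬Q0 | _     = ⊥-elim (¬Q0 (P⊆Q zero P0))
... | yes P0 | yes _  | zero  = ⊥-elim (¬Pw P0)
... | no _   | no ¬Q0 | zero  = ⊥-elim (¬Q0 Qw)
... | no _   | yes _  | zero  = s≤s (count-mono (P? ∘ suc) (Q? ∘ suc) (P⊆Q ∘ suc))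
... | yes _  | yes _  | suc w = s≤s (count-strict (P? ∘ suc) (Q? ∘ suc) (P⊆Q ∘ suc) w Qw ¬Pw)
... | no _   | yes _  | suc w = m≤n⇒m≤1+n (count-strict (P? ∘ suc) (Q? ∘ suc) (P⊆Q ∘ suc) w Qw ¬Pw)
... | no _   | no _   | suc w = count-strict (P? ∘ suc) (Q? ∘ suc) (P⊆Q ∘ suc) w Qw ¬Pw

private
  count-all : ∀ n → count {n} (λ _ → yes tt) ≡ n
  count-all zero    = refl
  count-all (suc n) = cong suc (count-all n)

count≤n : ∀ {n} {P : Fin n → Set} (P? : Decidable P) → count P? ≤ n
count≤n {n} P? = subst (count P? ≤_) (count-all n) (count-mono P? (λ _ → yes tt) (λ _ _ → tt))

count<n : ∀ {n} {P : Fin n → Set} (P? : Decidable P) → ∀ w → ¬ P w → count P? < n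
count<n {n} P? w ¬Pw = subst (count P? <_) (count-all n) (count-strict P? (λ _ → yes tt) (λ _ _ → tt) w tt ¬Pw)

injective⇒surjective : ∀ {n} (f : Fin n → Fin n) → Injective _≡_ _≡_ f → ∀ q → ∃[ v ] f v ≡ q
injective⇒surjective {suc m} f f-inj q with any? (λ v → f v ≟ q)
... | yes hit = hit
... | no miss = ⊥-elim (1+n≰n (injective⇒≤ punchOut∘f-injective))
  where
  q≢f : ∀ v → q ≢ f v
  q≢f v q≡fv = miss (v , sym q≡fv)
  punchOut∘f-injective : Injective _≡_ _≡_ (λ v → punchOut (q≢f v))
  punchOut∘f-injective eq = f-inj (punchOut-injective (q≢f _) (q≢f _) eq)

injective⇒permutation : ∀ {n} (f : Fin n → Fin n) → Injective _≡_ _≡_ f → Permutation′ n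
injective⇒permutation {n} f f-inj =
  permutation f f⁻¹ (λ q → proj₂ (surj q)) (λ v → f-inj (proj₂ (surj (f v))))
  where
  surj : ∀ q → ∃[ v ] f v ≡ q
  surj = injective⇒surjective f f-inj
  f⁻¹ : Fin n → Fin n
  f⁻¹ q = proj₁ (surj q)

-- Circular offsets and circular intervals

module _ {c : ℕ} where

  private
    N : ℕ
    N = suc c

  offset< : ∀ s p → offset c s p < N
  offset< s p = m%n<n (toℕ p + (N ∸ toℕ s)) N

  offset-≤ : ∀ {s p : Fin N} → toℕ s ≤ toℕ p → offset c s p ≡ toℕ p ∸ toℕ s
  offset-≤ {s} {p} s≤p = begin
    (toℕ p + (N ∸ toℕ s)) % N  ≡⟨ cong (_% N) (+-∸-assoc (toℕ p) (<⇒≤ (toℕ<n s))) ⟨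
    (toℕ p + N ∸ toℕ s) % N    ≡⟨ cong (_% N) (+-∸-comm N s≤p) ⟩
    (toℕ p ∸ toℕ s + N) % N    ≡⟨ [m+n]%n≡m%n (toℕ p ∸ toℕ s) N ⟩
    (toℕ p ∸ toℕ s) % N        ≡⟨ m<n⇒m%n≡m (≤-<-trans (m∸n≤m (toℕ p) (toℕ s)) (toℕ<n p)) ⟩
    toℕ p ∸ toℕ s              ∎
    where open ≡-Reasoning

  offset-> : ∀ {s p : Fin N} → toℕ p < toℕ s → offset c s p ≡ toℕ p + N ∸ toℕ s
  offset-> {s} {p} p<s = trans (m<n⇒m%n≡m p+[N∸s]<N) (sym (+-∸-assoc (toℕ p) (<⇒≤ (toℕ<n s))))
    where
    p+[N∸s]<N : toℕ p + (N ∸ toℕ s) < N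
    p+[N∸s]<N = begin-strict
      toℕ p + (N ∸ toℕ s)  <⟨ +-monoˡ-< (N ∸ toℕ s) p<s ⟩
      toℕ s + (N ∸ toℕ s)  ≡⟨ m+[n∸m]≡n (<⇒≤ (toℕ<n s)) ⟩
      N                    ∎
      where open ≤-Reasoning

  offset-self : ∀ s → offset c s s ≡ 0
  offset-self s = trans (offset-≤ {s} {s} ≤-refl) (n∸n≡0 (toℕ s))

  offset≡0⇒≡ : ∀ {s p} → offset c s p ≡ 0 → s ≡ p
  offset≡0⇒≡ {s} {p} eq with toℕ s ≤? toℕ p
  ... | yes s≤p = toℕ-injective (≤-antisym s≤p (m∸n≡0⇒m≤n (trans (sym (offset-≤ s≤p)) eq)))
  ... | no s≰p  = ⊥-elim (m<n⇒n≢0 N∸s≤p+N∸s (trans (sym (offset-> (≰⇒> s≰p))) eq))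
    where
    N∸s≤p+N∸s : 0 < toℕ p + N ∸ toℕ s
    N∸s≤p+N∸s = m<n⇒0<n∸m (<-≤-trans (toℕ<n s) (m≤n+m N (toℕ p)))

  private
    m<n+n⇒m≡m%n⊎m≡m%n+n : ∀ x → x < N + N → x ≡ x % N ⊎ x ≡ x % N + N
    m<n+n⇒m≡m%n⊎m≡m%n+n x x<2N with x <? N
    ... | yes x<N = inj₁ (sym (m<n⇒m%n≡m x<N))
    ... | no x≮N  = inj₂ (begin
      x            ≡⟨ m∸n+n≡m N≤x ⟨
      x ∸ N + N    ≡⟨ cong (_+ N) (m<n⇒m%n≡m (m<n+o⇒m∸n<o x N x<2N)) ⟨
      (x ∸ N) % N + N ≡⟨ cong (_+ N) (m≤n⇒[n∸m]%m≡n%m N≤x) ⟩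
      x % N + N    ∎)
      where
      open ≡-Reasoning
      N≤x : N ≤ x
      N≤x = ≮⇒≥ x≮N

  offset-triangle : ∀ s p q → let d = offset c s p + offset c p q in
    d ≡ offset c s q ⊎ d ≡ offset c s q + N
  offset-triangle s p q = subst (λ r → d ≡ r ⊎ d ≡ r + N) sum%N
    (m<n+n⇒m≡m%n⊎m≡m%n+n d (+-mono-< (offset< s p) (offset< p q)))
    where
    d A B C : ℕ
    d = offset c s p + offset c p q
    A = toℕ p + (N ∸ toℕ s)
    B = toℕ q + (N ∸ toℕ p)
    C = toℕ q + (N ∸ toℕ s)
    rearrange : ∀ p q x y → p + x + (q + y) ≡ q + x + (p + y)
    rearrange = solve-∀
    sum%N : d % N ≡ offset c s q
    sum%N = begin
      (A % N + B % N) % N  ≡⟨ %-distribˡ-+ A B N ⟨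
      (A + B) % N          ≡⟨ cong (_% N) (rearrange (toℕ p) (toℕ q) (N ∸ toℕ s) (N ∸ toℕ p)) ⟩
      (C + (toℕ p + (N ∸ toℕ p))) % N ≡⟨ cong (λ z → (C + z) % N) (m+[n∸m]≡n (<⇒≤ (toℕ<n p))) ⟩
      (C + N) % N          ≡⟨ [m+n]%n≡m%n C N ⟩
      C % N                ∎
      where open ≡-Reasoning

  offset-+ˡ : ∀ s p q → offset c s p ≤ offset c s q → offset c s p + offset c p q ≡ offset c s q
  offset-+ˡ s p q a≤d with offset-triangle s p q
  ... | inj₁ eq = eq
  ... | inj₂ eq = ⊥-elim (<⇒≱ (offset< p q) (+-cancelˡ-≤ (offset c s q) N (offset c p q) d+N≤d+b))
    where
    d+N≤d+b : offset c s q + N ≤ offset c s q + offset c p q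
    d+N≤d+b = ≤-trans (≤-reflexive (sym eq)) (+-monoˡ-≤ (offset c p q) a≤d)

  offset-+ʳ : ∀ s p q → offset c p q ≤ offset c s q → offset c s p + offset c p q ≡ offset c s q
  offset-+ʳ s p q b≤d with offset-triangle s p q
  ... | inj₁ eq = eq
  ... | inj₂ eq = ⊥-elim (<⇒≱ (offset< s p) (+-cancelʳ-≤ (offset c s q) N (offset c s p) N+d≤a+d))
    where
    N+d≤a+d : N + offset c s q ≤ offset c s p + offset c s q
    N+d≤a+d = ≤-trans (≤-reflexive (trans (+-comm N _) (sym eq))) (+-monoʳ-≤ (offset c s p) b≤d)

  offset-+-< : ∀ s p q → offset c s p + offset c p q < N → offset c s p + offset c p q ≡ offset c s q
  offset-+-< s p q sum<N with offset-triangle s p q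
  ... | inj₁ eq = eq
  ... | inj₂ eq = ⊥-elim (<⇒≱ sum<N (≤-trans (m≤n+m N (offset c s q)) (≤-reflexive (sym eq))))

  offset-surjective : ∀ s {a} → a < N → ∃[ p ] offset c s p ≡ a
  offset-surjective s {a} a<N with toℕ s + a <? N
  ... | yes s+a<N = fromℕ< s+a<N , (begin
    offset c s (fromℕ< s+a<N)  ≡⟨ offset-≤ (subst (toℕ s ≤_) (sym (toℕ-fromℕ< s+a<N)) (m≤m+n (toℕ s) a)) ⟩
    toℕ (fromℕ< s+a<N) ∸ toℕ s ≡⟨ cong (_∸ toℕ s) (toℕ-fromℕ< s+a<N) ⟩
    toℕ s + a ∸ toℕ s          ≡⟨ m+n∸m≡n (toℕ s) a ⟩
    a                          ∎)
    where open ≡-Reasoning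
  ... | no s+a≮N = fromℕ< p<N , (begin
    offset c s (fromℕ< p<N)         ≡⟨ offset-> (subst (_< toℕ s) (sym (toℕ-fromℕ< p<N)) p<s) ⟩
    toℕ (fromℕ< p<N) + N ∸ toℕ s    ≡⟨ cong (λ x → x + N ∸ toℕ s) (toℕ-fromℕ< p<N) ⟩
    toℕ s + a ∸ N + N ∸ toℕ s       ≡⟨ cong (_∸ toℕ s) (m∸n+n≡m (≮⇒≥ s+a≮N)) ⟩
    toℕ s + a ∸ toℕ s               ≡⟨ m+n∸m≡n (toℕ s) a ⟩
    a                               ∎)
    where
    open ≡-Reasoning
    p<N : toℕ s + a ∸ N < N
    p<N = m<n+o⇒m∸n<o (toℕ s + a) N (+-mono-< (toℕ<n s) a<N)
    p<s : toℕ s + a ∸ N < toℕ s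
    p<s = subst (toℕ s + a ∸ N <_) (m+n∸m≡n N (toℕ s))
      (∸-monoˡ-< (subst (toℕ s + a <_) (+-comm (toℕ s) N) (+-monoʳ-< (toℕ s) a<N)) (≮⇒≥ s+a≮N))

  offset-between⇔ : ∀ s p q → offset c s p ≤ offset c s q ⇔ offset c p q ≤ offset c s q
  offset-between⇔ s p q = mk⇔
    (λ a≤d → subst (offset c p q ≤_) (offset-+ˡ s p q a≤d) (m≤n+m (offset c p q) (offset c s p)))
    (λ b≤d → subst (offset c s p ≤_) (offset-+ʳ s p q b≤d) (m≤m+n (offset c s p) (offset c p q)))

  private
    m∸n<o⇔m<n+o : ∀ {m n o} → n ≤ m → m ∸ n < o ⇔ m < n + o
    m∸n<o⇔m<n+o {m} {n} {o} n≤m = mk⇔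
      (λ lt → subst (_< n + o) (m+[n∸m]≡n n≤m) (+-monoʳ-< n lt))
      (λ lt → subst (m ∸ n <_) (m+n∸m≡n n o) (∸-monoˡ-< lt n≤m))

  InUnrolledInt : ℕ → ℕ → ℕ → Set
  InUnrolledInt s l x = s ≤ x × x < s + l ⊎ x + N < s + l

  InCircInt⇔ : ∀ {s l} q → InCircInt c s l q ⇔ InUnrolledInt (toℕ s) l (toℕ q)
  InCircInt⇔ {s} {l} q with toℕ s ≤? toℕ q
  ... | yes s≤q = mk⇔ (λ q∈ → inj₁ (s≤q , Equivalence.to unfold q∈)) (Equivalence.from unfold ∘ below)
    where
    unfold : offset c s q < l ⇔ toℕ q < toℕ s + l
    unfold = ⇔-trans (mk⇔ (subst (_< l) (offset-≤ s≤q)) (subst (_< l) (sym (offset-≤ s≤q))))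
                     (m∸n<o⇔m<n+o s≤q)
    below : InUnrolledInt (toℕ s) l (toℕ q) → toℕ q < toℕ s + l
    below (inj₁ (_ , q<s+l)) = q<s+l
    below (inj₂ q+N<s+l)     = ≤-<-trans (m≤m+n (toℕ q) N) q+N<s+l
  ... | no s≰q = mk⇔ (inj₂ ∘ Equivalence.to unfold) (Equivalence.from unfold ∘ wrapped)
    where
    q<s : toℕ q < toℕ s
    q<s = ≰⇒> s≰q
    unfold : offset c s q < l ⇔ toℕ q + N < toℕ s + l
    unfold = ⇔-trans (mk⇔ (subst (_< l) (offset-> q<s)) (subst (_< l) (sym (offset-> q<s))))
                     (m∸n<o⇔m<n+o (≤-trans (<⇒≤ (toℕ<n s)) (m≤n+m N (toℕ q))))
    wrapped : InUnrolledInt (toℕ s) l (toℕ q) → toℕ q + N < toℕ s + l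
    wrapped (inj₁ (s≤q , _)) = ⊥-elim (s≰q s≤q)
    wrapped (inj₂ q+N<s+l)   = q+N<s+l

  InCircInt-interval : ∀ {s l} q → toℕ s + l ≤ N →
    InCircInt c s l q ⇔ (toℕ s ≤ toℕ q × toℕ q < toℕ s + l)
  InCircInt-interval {s} {l} q s+l≤N = ⇔-trans (InCircInt⇔ q) (mk⇔ unwrapped inj₁)
    where
    unwrapped : InUnrolledInt (toℕ s) l (toℕ q) → toℕ s ≤ toℕ q × toℕ q < toℕ s + l
    unwrapped (inj₁ q∈) = q∈
    unwrapped (inj₂ q+N<s+l) = ⊥-elim (<⇒≱ q+N<s+l (≤-trans s+l≤N (m≤n+m N (toℕ q))))

  InCircInt-cointerval : ∀ {s l} q → N ≤ toℕ s + l →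
    InCircInt c s l q ⇔ (toℕ s ≤ toℕ q ⊎ toℕ q < toℕ s + l ∸ N)
  InCircInt-cointerval {s} {l} q N≤s+l = ⇔-trans (InCircInt⇔ q) (mk⇔ to from)
    where
    to : InUnrolledInt (toℕ s) l (toℕ q) → toℕ s ≤ toℕ q ⊎ toℕ q < toℕ s + l ∸ N
    to (inj₁ (s≤q , _)) = inj₁ s≤q
    to (inj₂ q+N<s+l)   = inj₂ (m+n≤o⇒m≤o∸n (suc (toℕ q)) q+N<s+l)
    from : toℕ s ≤ toℕ q ⊎ toℕ q < toℕ s + l ∸ N → InUnrolledInt (toℕ s) l (toℕ q)
    from (inj₁ s≤q)     = inj₁ (s≤q , <-≤-trans (toℕ<n q) N≤s+l)
    from (inj₂ q<s+l∸N) = inj₂ (subst (toℕ q + N <_) (m∸n+n≡m N≤s+l) (+-monoˡ-< N q<s+l∸N))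

interval-circConsecutive : ∀ {m} (R : Fin (suc m) → Bool) {α β} → α ≤ β → β ≤ suc m →
  (∀ q → R q ≡ true ⇔ (α ≤ toℕ q × toℕ q < β)) → CircConsecutive (suc m) R
interval-circConsecutive {m} R {α} {β} α≤β β≤N R⇔ with α <? suc m
... | yes α<N = s , β ∸ α , ≤-trans (m∸n≤m β α) β≤N , λ q → ⇔-trans (R⇔ q) (⇔-sym (s∈⇔ q))
  where
  s : Fin (suc m)
  s = fromℕ< α<N
  end≡β : toℕ s + (β ∸ α) ≡ β
  end≡β = trans (cong (_+ (β ∸ α)) (toℕ-fromℕ< α<N)) (m+[n∸m]≡n α≤β)
  s∈⇔ : ∀ q → InCircInt m s (β ∸ α) q ⇔ (α ≤ toℕ q × toℕ q < β)
  s∈⇔ q = subst (InCircInt m s (β ∸ α) q ⇔_)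
    (cong₂ (λ a b → a ≤ toℕ q × toℕ q < b) (toℕ-fromℕ< α<N) end≡β)
    (InCircInt-interval q (≤-trans (≤-reflexive end≡β) β≤N))
... | no α≮N = zero , 0 , z≤n , λ q →
  mk⇔ (λ Rq → ⊥-elim (α≮N (≤-<-trans (proj₁ (Equivalence.to (R⇔ q) Rq)) (toℕ<n q)))) λ ()

cointerval-circConsecutive : ∀ {m} (R : Fin (suc m) → Bool) {α β} → β ≤ α → α ≤ suc m →
  (∀ q → R q ≡ true ⇔ (α ≤ toℕ q ⊎ toℕ q < β)) → CircConsecutive (suc m) R
cointerval-circConsecutive {m} R {α} {β} β≤α α≤N R⇔ with α <? suc m
... | yes α<N = s , l , l≤N , λ q → ⇔-trans (R⇔ q) (⇔-sym (s∈⇔ q))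
  where
  s : Fin (suc m)
  s = fromℕ< α<N
  l : ℕ
  l = suc m ∸ α + β
  l≤N : l ≤ suc m
  l≤N = ≤-trans (+-monoʳ-≤ (suc m ∸ α) β≤α) (≤-reflexive (m∸n+n≡m α≤N))
  end≡N+β : toℕ s + l ≡ suc m + β
  end≡N+β = begin
    toℕ s + l            ≡⟨ cong (_+ l) (toℕ-fromℕ< α<N) ⟩
    α + (suc m ∸ α + β)  ≡⟨ +-assoc α (suc m ∸ α) β ⟨
    α + (suc m ∸ α) + β  ≡⟨ cong (_+ β) (m+[n∸m]≡n α≤N) ⟩
    suc m + β            ∎
    where open ≡-Reasoning
  s∈⇔ : ∀ q → InCircInt m s l q ⇔ (α ≤ toℕ q ⊎ toℕ q < β)
  s∈⇔ q = subst (InCircInt m s l q ⇔_)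
    (cong₂ (λ a b → a ≤ toℕ q ⊎ toℕ q < b) (toℕ-fromℕ< α<N)
           (trans (cong (_∸ suc m) end≡N+β) (m+n∸m≡n (suc m) β)))
    (InCircInt-cointerval q (≤-trans (m≤m+n (suc m) β) (≤-reflexive (sym end≡N+β))))
... | no α≮N = zero , β , ≤-trans β≤α α≤N , λ q → ⇔-trans (R⇔ q) (mk⇔ (to q) (from q))
  where
  to : ∀ q → α ≤ toℕ q ⊎ toℕ q < β → InCircInt m zero β q
  to q (inj₁ α≤q) = ⊥-elim (α≮N (≤-<-trans α≤q (toℕ<n q)))
  to q (inj₂ q<β) = Equivalence.from (InCircInt-interval q (≤-trans β≤α α≤N)) (z≤n , q<β)
  from : ∀ q → InCircInt m zero β q → α ≤ toℕ q ⊎ toℕ q < β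
  from q q∈ = inj₂ (proj₂ (Equivalence.to (InCircInt-interval q (≤-trans β≤α α≤N)) q∈))

-- Arcs and circular-arc models

module _ {c : ℕ} where

  _∈A?_ : ∀ x (A : Arc c) → Dec (x ∈A A)
  x ∈A? A = offset c (start A) x <? len A

  start∈A : ∀ (A : Arc c) → start A ∈A A
  start∈A A = subst (λ d → d < len A) (sym (offset-self {c} (start A))) (len≥1 A)

  later-start-∈A : ∀ {A B : Arc c} {x} → ¬ ProperSubArc A B → x ∈A B →
    offset c (start A) x ≤ offset c (start B) x → x ∈A A
  later-start-∈A {A} {B} {x} A⊄B x∈B sA≤sB with x ∈A? A
  ... | yes x∈A = x∈A
  ... | no x∉A  = ⊥-elim (A⊄B (A⊆B , x , x∈B , x∉A))
    where
    a : ℕ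
    a = offset c (start B) (start A)
    a+sA≡sB : a + offset c (start A) x ≡ offset c (start B) x
    a+sA≡sB = offset-+ʳ (start B) (start A) x sA≤sB
    A⊆B : ∀ p → p ∈A A → p ∈A B
    A⊆B p p∈A = subst (_< len B) (offset-+-< (start B) (start A) p (<-trans a+b<sB (offset< (start B) x)))
                                 (<-trans a+b<sB x∈B)
      where
      a+b<sB : a + offset c (start A) p < offset c (start B) x
      a+b<sB = subst (a + offset c (start A) p <_) a+sA≡sB (+-monoʳ-< a (<-≤-trans p∈A (≮⇒≥ x∉A)))

  meet⇒start∈ : ∀ {A B : Arc c} → Intersect A B → start B ∈A A ⊎ start A ∈A B
  meet⇒start∈ {A} {B} (x , x∈A , x∈B) with offset c (start B) x ≤? offset c (start A) x
  ... | yes B≤A = inj₁ (≤-<-trans (Equivalence.from (offset-between⇔ (start A) (start B) x) B≤A) x∈A)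
  ... | no B≰A  = inj₂ (≤-<-trans (Equivalence.from (offset-between⇔ (start B) (start A) x) (<⇒≤ (≰⇒> B≰A)))
                                  x∈B)

does≡true⇒ : ∀ {P : Set} (P? : Dec P) → does P? ≡ true → P
does≡true⇒ (yes p) _ = p

module _ {n c} (G : SimpleGraph n) (A : Fin n → Arc c) (A-model : IsCAModel G A) where

  intersecting⇒clique : ∀ {S} → (∀ u v → u ∈ₛ S → v ∈ₛ S → Intersect (A u) (A v)) → IsClique G S
  intersecting⇒clique S-meet u v u∈S v∈S u≢v = Equivalence.from (A-model u v u≢v) (S-meet u v u∈S v∈S)

  clique⇒intersecting : ∀ {S} → IsClique G S → ∀ u v → u ∈ₛ S → v ∈ₛ S → Intersect (A u) (A v)
  clique⇒intersecting S-clique u v u∈S v∈S with u ≟ v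
  ... | yes refl = start (A u) , start∈A (A u) , start∈A (A u)
  ... | no u≢v   = Equivalence.to (A-model u v u≢v) (S-clique u v u∈S v∈S u≢v)

  maxClique-through : ∀ {S} x → IsMaxClique G S → (∀ v → v ∈ₛ S → x ∈A A v) →
    ∀ v → x ∈A A v → v ∈ₛ S
  maxClique-through {S} x (_ , S-maximal) S∋x v x∈Av =
    S-maximal through through-clique (λ u u∈S → dec-true (x ∈A? A u) (S∋x u u∈S))
              v (dec-true (x ∈A? A v) x∈Av)
    where
    through : VSet n
    through u = does (x ∈A? A u)
    through-clique : IsClique G through
    through-clique u w u∈ w∈ u≢w = Equivalence.from (A-model u w u≢w)
      (x , does≡true⇒ (x ∈A? A u) u∈ , does≡true⇒ (x ∈A? A w) w∈)

module _ {n c} (A : Fin n → Arc c) (x : Fin (suc c)) where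

  private
    StartsAtLeast : ℕ → Set
    StartsAtLeast j = ∃[ w ] x ∈A A w × j ≤ offset c (start (A w)) x

    startsAtLeast? : ∀ j → Dec (StartsAtLeast j)
    startsAtLeast? j = any? λ w → (x ∈A? A w) ×-dec (j ≤? offset c (start (A w)) x)

  farthestStart : ∃[ v ] x ∈A A v →
    ∃[ w ] x ∈A A w × (∀ v → x ∈A A v → offset c (start (A v)) x ≤ offset c (start (A w)) x)
  farthestStart (v , x∈Av) with greatest startsAtLeast? (v , x∈Av , z≤n) c
  ... | record { holds = (w , x∈Aw , value≤w) ; maximal = maximal } =
    w , x∈Aw , λ u x∈Au → ≤-trans (maximal (s≤s⁻¹ (offset< (start (A u)) x)) (u , x∈Au , ≤-refl)) value≤w

  through⇔start-between : IsProperModel A → ∀ {w} → x ∈A A w →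
    (∀ v → x ∈A A v → offset c (start (A v)) x ≤ offset c (start (A w)) x) →
    ∀ v → x ∈A A v ⇔ InCircInt c (start (A w)) (suc (offset c (start (A w)) x)) (start (A v))
  through⇔start-between A-proper {w} x∈Aw farthest v = mk⇔
    (λ x∈Av → s≤s (Equivalence.from between⇔ (farthest v x∈Av)))
    (λ v∈ → later-start-∈A {A = A v} {B = A w} {x = x} (A-proper v w) x∈Aw (Equivalence.to between⇔ (s≤s⁻¹ v∈)))
    where
    between⇔ : offset c (start (A w)) (start (A v)) ≤ offset c (start (A w)) x
             ⇔ offset c (start (A v)) x ≤ offset c (start (A w)) x
    between⇔ = offset-between⇔ (start (A w)) (start (A v)) x

-- Extending cliques to maximal cliques

module _ {n : ℕ} where

  ∅ : VSet n
  ∅ _ = false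

  insert : Fin n → VSet n → VSet n
  insert v X u with u ≟ v
  ... | yes _ = true
  ... | no _  = X u

  ∈-insert⁻ : ∀ {v X} u → u ∈ₛ insert v X → u ≡ v ⊎ u ∈ₛ X
  ∈-insert⁻ {v} u u∈ with u ≟ v
  ... | yes u≡v = inj₁ u≡v
  ... | no _    = inj₂ u∈

  ∈-insert : ∀ v X → v ∈ₛ insert v X
  ∈-insert v X with v ≟ v
  ... | yes _  = refl
  ... | no v≢v = ⊥-elim (v≢v refl)

  ⊆-insert : ∀ v X → X ⊆ₛ insert v X
  ⊆-insert v X u u∈ with u ≟ v
  ... | yes _ = refl
  ... | no _  = u∈

module _ {n : ℕ} (G : SimpleGraph n) where

  Compatible : Fin n → VSet n → Set
  Compatible v X = ∀ u → u ∈ₛ X → u ≢ v → Adj G u v ≡ true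

  compatible? : ∀ v X → Dec (Compatible v X)
  compatible? v X = all? λ u → (X u ≟ᵇ true) →-dec (¬? (u ≟ v) →-dec (Adj G u v ≟ᵇ true))

  insert-clique : ∀ {v X} → IsClique G X → Compatible v X → IsClique G (insert v X)
  insert-clique {v} X-clique v-compat a b a∈ b∈ a≢b with ∈-insert⁻ a a∈ | ∈-insert⁻ b b∈
  ... | inj₁ refl | inj₁ refl = ⊥-elim (a≢b refl)
  ... | inj₁ refl | inj₂ b∈X  = trans (Adj-sym G a b) (v-compat b b∈X (a≢b ∘ sym))
  ... | inj₂ a∈X  | inj₁ refl = v-compat a a∈X a≢b
  ... | inj₂ a∈X  | inj₂ b∈X  = X-clique a b a∈X b∈X a≢b

  tryInsert : Fin n → VSet n → VSet n
  tryInsert v X with compatible? v X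
  ... | yes _ = insert v X
  ... | no _  = X

  tryInsert-clique : ∀ v {X} → IsClique G X → IsClique G (tryInsert v X)
  tryInsert-clique v {X} X-clique with compatible? v X
  ... | yes v-compat = insert-clique X-clique v-compat
  ... | no _         = X-clique

  ⊆-tryInsert : ∀ v X → X ⊆ₛ tryInsert v X
  ⊆-tryInsert v X with compatible? v X
  ... | yes _ = ⊆-insert v X
  ... | no _  = λ _ u∈ → u∈

  Settled : VSet n → Fin n → Set
  Settled X v = v ∈ₛ X ⊎ ¬ Compatible v X

  settled-mono : ∀ {X Y v} → X ⊆ₛ Y → Settled X v → Settled Y v
  settled-mono X⊆Y (inj₁ v∈X)     = inj₁ (X⊆Y _ v∈X)
  settled-mono X⊆Y (inj₂ ¬compat) = inj₂ λ compat → ¬compat λ u u∈X → compat u (X⊆Y u u∈X)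

  tryInsert-settles : ∀ v X → Settled (tryInsert v X) v
  tryInsert-settles v X with compatible? v X
  ... | yes _      = inj₁ (∈-insert v X)
  ... | no ¬compat = inj₂ ¬compat

  saturate : List (Fin n) → VSet n → VSet n
  saturate []       X = X
  saturate (v ∷ vs) X = saturate vs (tryInsert v X)

  saturate-clique : ∀ vs {X} → IsClique G X → IsClique G (saturate vs X)
  saturate-clique []       X-clique = X-clique
  saturate-clique (v ∷ vs) X-clique = saturate-clique vs (tryInsert-clique v X-clique)

  ⊆-saturate : ∀ vs X → X ⊆ₛ saturate vs X
  ⊆-saturate []       X u u∈ = u∈
  ⊆-saturate (v ∷ vs) X u u∈ = ⊆-saturate vs (tryInsert v X) u (⊆-tryInsert v X u u∈)

  saturate-settles : ∀ {v vs} X → v ∈ vs → Settled (saturate vs X) v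
  saturate-settles {vs = v ∷ vs} X (here refl) =
    settled-mono (⊆-saturate vs (tryInsert v X)) (tryInsert-settles v X)
  saturate-settles {vs = _ ∷ vs} X (there v∈vs) = saturate-settles (tryInsert _ X) v∈vs

  extendToMaxClique : ∀ {S} → IsClique G S → ∃[ X ] IsMaxClique G X × S ⊆ₛ X
  extendToMaxClique {S} S-clique = X , (saturate-clique (allFin n) S-clique , maximal) , ⊆-saturate (allFin n) S
    where
    X : VSet n
    X = saturate (allFin n) S
    maximal : ∀ Y → IsClique G Y → X ⊆ₛ Y → Y ⊆ₛ X
    maximal Y Y-clique X⊆Y w w∈Y with saturate-settles S (∈-allFin w)
    ... | inj₁ w∈X     = w∈X
    ... | inj₂ ¬compat = ⊥-elim (¬compat λ u u∈X → Y-clique u w (X⊆Y u u∈X) w∈Y)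

  singleton-clique : ∀ v → IsClique G (insert v ∅)
  singleton-clique v = insert-clique (λ _ _ ()) (λ _ ())

  edge-clique : ∀ {u v} → Adj G u v ≡ true → IsClique G (insert u (insert v ∅))
  edge-clique {u} {v} uv = insert-clique (singleton-clique v) u-compat
    where
    u-compat : Compatible u (insert v ∅)
    u-compat w w∈ _ with ∈-insert⁻ w w∈
    ... | inj₁ refl = trans (Adj-sym G w u) uv

  maxClique-nonempty : ∀ {S} → Fin n → IsMaxClique G S → ∃[ v ] v ∈ₛ S
  maxClique-nonempty {S} w (_ , maximal) with any? (λ v → S v ≟ᵇ true)
  ... | yes found = found
  ... | no none   =
    w , maximal (insert w ∅) (singleton-clique w) (λ v v∈S → ⊥-elim (none (v , v∈S))) w (∈-insert w ∅)

module _ {n k} (G : SimpleGraph n) (Q : BMatrix k n) (Q-cliqueMatrix : IsCliqueMatrix G Q) where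

  clique⊆row : ∀ {S} → IsClique G S → ∃[ i ] S ⊆ₛ Q i
  clique⊆row S-clique with extendToMaxClique G S-clique
  ... | X , X-max , S⊆X with proj₂ (proj₂ Q-cliqueMatrix) X X-max
  ...   | i , Qi≗X = i , λ v v∈S → trans (Qi≗X v) (S⊆X v v∈S)

  edge⇒row : ∀ {u v} → Adj G u v ≡ true → ∃[ i ] u ∈ₛ Q i × v ∈ₛ Q i
  edge⇒row {u} {v} uv with clique⊆row (edge-clique G uv)
  ... | i , pair⊆Qi = i , pair⊆Qi u (∈-insert u _) , pair⊆Qi v (⊆-insert u _ v (∈-insert v ∅))

-- Ranking by a key on the circle

module Ranking {m c : ℕ} (key : Fin (suc m) → Fin (suc c)) where

  private
    n : ℕ
    n = suc m
    module Lex = StrictTotalOrder (×-strictTotalOrder <-strictTotalOrder (Fin.<-strictTotalOrder n))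

  _≺_ : Fin n → Fin n → Set
  u ≺ w = Lex._<_ (toℕ (key u) , u) (toℕ (key w) , w)

  ≺-irrefl : ∀ w → ¬ w ≺ w
  ≺-irrefl w = Lex.irrefl (refl , refl)

  _≺?_ : ∀ u w → Dec (u ≺ w)
  u ≺? w = Lex._<?_ (toℕ (key u) , u) (toℕ (key w) , w)

  keyBelow? : ∀ a u → Dec (toℕ (key u) < a)
  keyBelow? a u = toℕ (key u) <? a

  rank : Fin n → ℕ
  rank w = count (_≺? w)

  below : ℕ → ℕ
  below a = count (keyBelow? a)

  rank-mono : ∀ {u w} → u ≺ w → rank u < rank w
  rank-mono {u} u≺w = count-strict (_≺? u) (_≺? _) (λ z z≺u → Lex.trans z≺u u≺w) u u≺w (≺-irrefl u)

  rank-injective : ∀ {u w} → rank u ≡ rank w → u ≡ w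
  rank-injective {u} {w} eq with Lex.compare (toℕ (key u) , u) (toℕ (key w) , w)
  ... | tri< u≺w _ _ = ⊥-elim (<-irrefl eq (rank-mono u≺w))
  ... | tri≈ _ (_ , u≡w) _ = u≡w
  ... | tri> _ _ w≺u = ⊥-elim (<-irrefl (sym eq) (rank-mono w≺u))

  rank<n : ∀ w → rank w < n
  rank<n w = count<n (_≺? w) w (≺-irrefl w)

  below-mono : ∀ {a b} → a ≤ b → below a ≤ below b
  below-mono {a} {b} a≤b = count-mono (keyBelow? a) (keyBelow? b) (λ u lt → <-≤-trans lt a≤b)

  below≤n : ∀ a → below a ≤ n
  below≤n a = count≤n (keyBelow? a)

  below≤rank : ∀ {a w} → a ≤ toℕ (key w) → below a ≤ rank w
  below≤rank {a} {w} a≤w = count-mono (keyBelow? a) (_≺? w) (λ u u<a → inj₁ (<-≤-trans u<a a≤w))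

  rank<below : ∀ {a w} → toℕ (key w) < a → rank w < below a
  rank<below {a} {w} w<a = count-strict (_≺? w) (keyBelow? a) ≺w⇒<a w w<a (≺-irrefl w)
    where
    ≺w⇒<a : ∀ u → u ≺ w → toℕ (key u) < a
    ≺w⇒<a u (inj₁ u<w)       = <-trans u<w w<a
    ≺w⇒<a u (inj₂ (u≡w , _)) = subst (_< a) (sym u≡w) w<a

  below≤rank⇔ : ∀ {a w} → below a ≤ rank w ⇔ a ≤ toℕ (key w)
  below≤rank⇔ {a} {w} = mk⇔ (λ le → ≮⇒≥ (λ w<a → <⇒≱ (rank<below w<a) le)) below≤rank

  rank<below⇔ : ∀ {a w} → rank w < below a ⇔ toℕ (key w) < a
  rank<below⇔ {a} {w} = mk⇔ (λ lt → ≰⇒> (λ a≤w → <⇒≱ lt (below≤rank a≤w))) rank<below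

  order : Permutation′ n
  order = injective⇒permutation (λ w → fromℕ< (rank<n w)) fromℕ<-rank-injective
    where
    fromℕ<-rank-injective : ∀ {u w} → fromℕ< (rank<n u) ≡ fromℕ< (rank<n w) → u ≡ w
    fromℕ<-rank-injective {u} {w} eq = rank-injective (fromℕ<-injective _ _ (rank<n u) (rank<n w) eq)

  rank-order : ∀ q → rank (order ⟨$⟩ˡ q) ≡ toℕ q
  rank-order q = trans (sym (toℕ-fromℕ< (rank<n (order ⟨$⟩ˡ q)))) (cong toℕ (inverseʳ order))

  preimage-circConsecutive : ∀ (R : Fin n → Bool) s {l} → l ≤ suc c →
    (∀ v → R v ≡ true ⇔ InCircInt c s l (key v)) → CircConsecutive n (R ∘ (order ⟨$⟩ˡ_))
  preimage-circConsecutive R s {l} l≤N R⇔ with toℕ s + l ≤? suc c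
  ... | yes s+l≤N =
    interval-circConsecutive (R ∘ (order ⟨$⟩ˡ_)) (below-mono (m≤m+n (toℕ s) l)) (below≤n (toℕ s + l)) R⇔rank
    where
    R⇔rank : ∀ q → R (order ⟨$⟩ˡ q) ≡ true ⇔ (below (toℕ s) ≤ toℕ q × toℕ q < below (toℕ s + l))
    R⇔rank q = subst (λ r → R (order ⟨$⟩ˡ q) ≡ true ⇔ (below (toℕ s) ≤ r × r < below (toℕ s + l))) (rank-order q)
      (⇔-trans (R⇔ _) (⇔-trans (InCircInt-interval _ s+l≤N) (⇔-sym below≤rank⇔ ×-⇔ ⇔-sym rank<below⇔)))
  ... | no s+l≰N =
    cointerval-circConsecutive (R ∘ (order ⟨$⟩ˡ_)) (below-mono wrapped≤s) (below≤n (toℕ s)) R⇔rank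
    where
    wrapped≤s : toℕ s + l ∸ suc c ≤ toℕ s
    wrapped≤s = ≤-trans (∸-monoˡ-≤ (suc c) (+-monoʳ-≤ (toℕ s) l≤N)) (≤-reflexive (m+n∸n≡m (toℕ s) (suc c)))
    R⇔rank : ∀ q → R (order ⟨$⟩ˡ q) ≡ true ⇔ (below (toℕ s) ≤ toℕ q ⊎ toℕ q < below (toℕ s + l ∸ suc c))
    R⇔rank q = subst (λ r → R (order ⟨$⟩ˡ q) ≡ true ⇔ (below (toℕ s) ≤ r ⊎ r < below (toℕ s + l ∸ suc c))) (rank-order q)
      (⇔-trans (R⇔ _) (⇔-trans (InCircInt-cointerval _ (≰⇒≥ s+l≰N)) (⇔-sym below≤rank⇔ ⊎-⇔ ⇔-sym rank<below⇔)))

-- From a proper Helly model to a circular-ones ordering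

module _ {m k c} (G : SimpleGraph (suc m)) (Q : BMatrix k (suc m)) (Q-cliqueMatrix : IsCliqueMatrix G Q)
         (A : Fin (suc m) → Arc c) (A-model : IsCAModel G A) (A-proper : IsProperModel A) (A-helly : IsHellyModel A)
         where

  open Ranking (start ∘ A)

  private
    Qi-max : ∀ i → IsMaxClique G (Q i)
    Qi-max i = proj₁ Q-cliqueMatrix i

    Qi-nonempty : ∀ i → ∃[ v ] v ∈ₛ Q i
    Qi-nonempty i = maxClique-nonempty G zero (Qi-max i)

  row-circConsecutive : ∀ i → CircConsecutive (suc m) (λ q → Q i (order ⟨$⟩ˡ q))
  row-circConsecutive i with A-helly (Q i) (Qi-nonempty i) (clique⇒intersecting G A A-model (proj₁ (Qi-max i)))
  ... | x , Qi∋x with farthestStart A x (map₂ (λ {v} → Qi∋x v) (Qi-nonempty i))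
  ...   | w , x∈Aw , farthest = preimage-circConsecutive (Q i) (start (A w)) (offset< (start (A w)) x) row⇔
    where
    row⇔ : ∀ v → Q i v ≡ true ⇔ InCircInt c (start (A w)) (suc (offset c (start (A w)) x)) (start (A v))
    row⇔ v = ⇔-trans (mk⇔ (Qi∋x v) (maxClique-through G A A-model x (Qi-max i) Qi∋x v))
                     (through⇔start-between A x A-proper x∈Aw farthest v)

  properHelly⇒circularOnes : CircularOnesRows Q
  properHelly⇒circularOnes = order , row-circConsecutive

-- From a circular-ones ordering to a proper Helly model

module _ (m : ℕ) where

  private
    n : ℕ
    n = suc m

  scaled<⇔ : ∀ {x e} → e ≤ m → x * n < e * m + n ⇔ x ≤ e
  scaled<⇔ {x} {e} e≤m = mk⇔ to from
    where
    to : x * n < e * m + n → x ≤ e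
    to xn< = ≮⇒≥ λ e<x → <⇒≱ xn< (begin
      e * m + n      ≤⟨ +-monoˡ-≤ n (*-monoʳ-≤ e (n≤1+n m)) ⟩
      e * n + n      ≡⟨ +-comm (e * n) n ⟩
      suc e * n      ≤⟨ *-monoˡ-≤ n e<x ⟩
      x * n          ∎)
      where open ≤-Reasoning
    from : x ≤ e → x * n < e * m + n
    from x≤e = begin-strict
      x * n          ≤⟨ *-monoˡ-≤ n x≤e ⟩
      e * n          ≡⟨ *-suc e m ⟩
      e + e * m      <⟨ +-monoˡ-< (e * m) (s≤s e≤m) ⟩
      n + e * m      ≡⟨ +-comm n (e * m) ⟩
      e * m + n      ∎
      where open ≤-Reasoning

  scaledLength≤ : ∀ {e} → e ≤ m → e * m + n ≤ n * n
  scaledLength≤ {e} e≤m = begin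
    e * m + n      ≤⟨ +-monoˡ-≤ n (*-monoˡ-≤ m e≤m) ⟩
    m * m + n      ≤⟨ +-monoˡ-≤ n (*-monoʳ-≤ m (n≤1+n m)) ⟩
    m * n + n      ≡⟨ +-comm (m * n) n ⟩
    n * n          ∎
    where open ≤-Reasoning

  scaledLength< : ∀ {e} → 1 ≤ m → e ≤ m → e * m + n < n * n
  scaledLength< {e} 1≤m e≤m = begin-strict
    e * m + n      ≤⟨ +-monoˡ-≤ n (*-monoˡ-≤ m e≤m) ⟩
    m * m + n      <⟨ +-monoˡ-< n (*-monoʳ-< m ≤-refl) ⟩
    m * n + n      ≡⟨ +-comm (m * n) n ⟩
    n * n          ∎
    where
    open ≤-Reasoning
    instance
      m≢0 : NonZero m
      m≢0 = >-nonZero 1≤m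

  scaledEnd< : ∀ {d e e′} → 1 ≤ d → e′ ≤ e + d → d * n ≤ e′ * m + n → e′ * m + n ∸ d * n < e * m + n
  scaledEnd< {d} {e} {e′} 1≤d e′≤e+d dn≤ = subst (e′ * m + n ∸ d * n <_) (m+n∸n≡m (e * m + n) (d * n))
    (∸-monoˡ-< (begin-strict
      e′ * m + n         ≤⟨ +-monoˡ-≤ n (*-monoˡ-≤ m e′≤e+d) ⟩
      (e + d) * m + n    <⟨ m<m+n ((e + d) * m + n) 1≤d ⟩
      (e + d) * m + n + d ≡⟨ rearrange e d m ⟩
      e * m + n + d * n  ∎) dn≤)
    where
    open ≤-Reasoning
    rearrange : ∀ e d m → (e + d) * m + suc m + d ≡ e * m + suc m + d * suc m
    rearrange = solve-∀

module _ {m k} (G : SimpleGraph (suc m)) (Q : BMatrix k (suc m)) (Q-cliqueMatrix : IsCliqueMatrix G Q)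
         (π : Permutation′ (suc m)) (Q-circular : ∀ i → CircConsecutive (suc m) (λ q → Q i (π ⟨$⟩ˡ q)))
         where

  private
    n : ℕ
    n = suc m

  pos : Fin n → Fin n
  pos v = π ⟨$⟩ʳ v

  pos-injective : ∀ {u v} → pos u ≡ pos v → u ≡ v
  pos-injective {u} {v} eq = trans (sym (inverseˡ π)) (trans (cong (π ⟨$⟩ˡ_) eq) (inverseˡ π))

  rowStart : Fin k → Fin n
  rowStart i = proj₁ (Q-circular i)

  rowLength : Fin k → ℕ
  rowLength i = proj₁ (proj₂ (Q-circular i))

  rowLength≤n : ∀ i → rowLength i ≤ n
  rowLength≤n i = proj₁ (proj₂ (proj₂ (Q-circular i)))

  row⇔ : ∀ i v → v ∈ₛ Q i ⇔ offset m (rowStart i) (pos v) < rowLength i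
  row⇔ i v = subst (λ u → u ∈ₛ Q i ⇔ offset m (rowStart i) (pos v) < rowLength i) (inverseˡ π)
                   (proj₂ (proj₂ (proj₂ (Q-circular i))) (pos v))

  Run : Fin n → ℕ → Set
  Run p j = ∀ u w → offset m p (pos u) ≤ j → offset m p (pos w) ≤ j → u ≢ w → Adj G u w ≡ true

  run? : ∀ p j → Dec (Run p j)
  run? p j = all? λ u → all? λ w →
    (offset m p (pos u) ≤? j) →-dec (offset m p (pos w) ≤? j) →-dec ¬? (u ≟ w) →-dec (Adj G u w ≟ᵇ true)

  run-zero : ∀ p → Run p 0
  run-zero p u w pu≤0 pw≤0 u≢w = ⊥-elim (u≢w (pos-injective (trans (sym (at-p pu≤0)) (at-p pw≤0))))
    where
    at-p : ∀ {q} → offset m p q ≤ 0 → p ≡ q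
    at-p pq≤0 = offset≡0⇒≡ (n≤0⇒n≡0 pq≤0)

  private
    reachOf : ∀ p → Greatest (Run p) m
    reachOf p = greatest (run? p) (run-zero p) m

  reach : Fin n → ℕ
  reach p = Greatest.value (reachOf p)

  reach≤m : ∀ p → reach p ≤ m
  reach≤m p = Greatest.value≤ (reachOf p)

  run-reach : ∀ p → Run p (reach p)
  run-reach p = Greatest.holds (reachOf p)

  reach-maximal : ∀ p {j} → j ≤ m → Run p j → j ≤ reach p
  reach-maximal p = Greatest.maximal (reachOf p)

  reach-adjacent : ∀ {u v} → offset m (pos u) (pos v) ≤ reach (pos u) → u ≢ v → Adj G u v ≡ true
  reach-adjacent {u} {v} uv≤reach u≢v =
    run-reach (pos u) u v (subst (_≤ reach (pos u)) (sym (offset-self (pos u))) z≤n) uv≤reach u≢v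

  row-run : ∀ i p j → offset m (rowStart i) p + j < rowLength i → Run p j
  row-run i p j end<l u w pu≤j pw≤j u≢w =
    proj₁ (proj₁ Q-cliqueMatrix i) u w (inRow u pu≤j) (inRow w pw≤j) u≢w
    where
    s : Fin n
    s = rowStart i
    inRow : ∀ v → offset m p (pos v) ≤ j → v ∈ₛ Q i
    inRow v pv≤j = Equivalence.from (row⇔ i v)
      (subst (_< rowLength i) (offset-+-< s p (pos v) (<-≤-trans sv<l (rowLength≤n i))) sv<l)
      where
      sv<l : offset m s p + offset m p (pos v) < rowLength i
      sv<l = ≤-<-trans (+-monoʳ-≤ (offset m s p) pv≤j) end<l

  row-reach : ∀ i {p q} → offset m (rowStart i) p ≤ offset m (rowStart i) q →
    offset m (rowStart i) q < rowLength i → offset m p q ≤ reach p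
  row-reach i {p} {q} sp≤sq sq<l = reach-maximal p (s≤s⁻¹ (offset< p q))
    (row-run i p (offset m p q) (subst (_< rowLength i) (sym (offset-+ˡ (rowStart i) p q sp≤sq)) sq<l))

  reach-step : ∀ p q → offset m q p ≤ reach q → reach q ≤ reach p + offset m q p
  reach-step p q d≤reach = begin
    reach q                ≤⟨ m≤n+m∸n (reach q) d ⟩
    d + (reach q ∸ d)      ≤⟨ +-monoʳ-≤ d (reach-maximal p (≤-trans (m∸n≤m (reach q) d) (reach≤m q)) run) ⟩
    d + reach p            ≡⟨ +-comm d (reach p) ⟩
    reach p + d            ∎
    where
    open ≤-Reasoning
    d : ℕ
    d = offset m q p
    within : ∀ v → offset m p (pos v) ≤ reach q ∸ d → offset m q (pos v) ≤ reach q
    within v pv≤ = subst (_≤ reach q) (offset-+-< q p (pos v) (s≤s (≤-trans qv≤ (reach≤m q)))) qv≤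
      where
      qv≤ : d + offset m p (pos v) ≤ reach q
      qv≤ = ≤-trans (+-monoʳ-≤ d pv≤) (≤-reflexive (m+[n∸m]≡n d≤reach))
    run : Run p (reach q ∸ d)
    run u w pu≤ pw≤ = run-reach q u w (within u pu≤) (within w pw≤)

  -- suc C is n * n by definition: the circle of the model consists of n blocks of n points.
  C : ℕ
  C = m + m * n

  scale : Fin n → Fin (suc C)
  scale p = fromℕ< (*-monoˡ-< n (toℕ<n p))

  offset-scale : ∀ p q → offset C (scale p) (scale q) ≡ offset m p q * n
  offset-scale p q = begin
    (toℕ (scale q) + (n * n ∸ toℕ (scale p))) % (n * n)
      ≡⟨ cong₂ (λ x y → (x + (n * n ∸ y)) % (n * n))
               (toℕ-fromℕ< (*-monoˡ-< n (toℕ<n q))) (toℕ-fromℕ< (*-monoˡ-< n (toℕ<n p))) ⟩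
    (toℕ q * n + (n * n ∸ toℕ p * n)) % (n * n)
      ≡⟨ cong (λ z → (toℕ q * n + z) % (n * n)) (*-distribʳ-∸ n n (toℕ p)) ⟨
    (toℕ q * n + (n ∸ toℕ p) * n) % (n * n)
      ≡⟨ cong (_% (n * n)) (*-distribʳ-+ n (toℕ q) (n ∸ toℕ p)) ⟨
    (toℕ q + (n ∸ toℕ p)) * n % (n * n)
      ≡⟨ m%n*o≡m*o%[n*o] (toℕ q + (n ∸ toℕ p)) n n ⟨
    offset m p q * n ∎
    where open ≡-Reasoning

  -- reach p * m + n = (reach p + 1) * n ∸ reach p.
  arcLength : Fin n → ℕ
  arcLength p = reach p * m + n

  arcAt : Fin n → Arc C
  arcAt p = arc (scale p) (arcLength p) (≤-trans (s≤s z≤n) (m≤n+m n (reach p * m))) (scaledLength≤ m (reach≤m p))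

  scale∈arcAt⇔ : ∀ p q → scale q ∈A arcAt p ⇔ offset m p q ≤ reach p
  scale∈arcAt⇔ p q = subst (λ d → d < arcLength p ⇔ offset m p q ≤ reach p) (sym (offset-scale p q))
    (scaled<⇔ m (reach≤m p))

  arcs : Fin n → Arc C
  arcs v = arcAt (pos v)

  reach⇒meet : ∀ {u v} → offset m (pos u) (pos v) ≤ reach (pos u) → Intersect (arcs u) (arcs v)
  reach⇒meet {u} {v} uv≤reach =
    scale (pos v) , Equivalence.from (scale∈arcAt⇔ (pos u) (pos v)) uv≤reach , start∈A (arcs v)

  row⇒meet : ∀ i {u v} → u ∈ₛ Q i → v ∈ₛ Q i → Intersect (arcs u) (arcs v)
  row⇒meet i {u} {v} u∈Qi v∈Qi =
    [ u-first , v-first ]′ (≤-total (offset m (rowStart i) (pos u)) (offset m (rowStart i) (pos v)))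
    where
    u-first : offset m (rowStart i) (pos u) ≤ offset m (rowStart i) (pos v) → Intersect (arcs u) (arcs v)
    u-first u≤v = reach⇒meet {u} {v} (row-reach i {pos u} {pos v} u≤v (Equivalence.to (row⇔ i v) v∈Qi))
    v-first : offset m (rowStart i) (pos v) ≤ offset m (rowStart i) (pos u) → Intersect (arcs u) (arcs v)
    v-first v≤u = map₂ swap (reach⇒meet {v} {u} (row-reach i {pos v} {pos u} v≤u (Equivalence.to (row⇔ i u) u∈Qi)))

  adjacent⇒meet : ∀ {u v} → Adj G u v ≡ true → Intersect (arcs u) (arcs v)
  adjacent⇒meet uv = let i , u∈Qi , v∈Qi = edge⇒row G Q Q-cliqueMatrix uv in row⇒meet i u∈Qi v∈Qi

  meet⇒adjacent : ∀ {u v} → u ≢ v → Intersect (arcs u) (arcs v) → Adj G u v ≡ true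
  meet⇒adjacent {u} {v} u≢v meet with meet⇒start∈ {A = arcs u} {B = arcs v} meet
  ... | inj₁ v∈Au = reach-adjacent (Equivalence.to (scale∈arcAt⇔ (pos u) (pos v)) v∈Au) u≢v
  ... | inj₂ u∈Av =
    trans (Adj-sym G u v) (reach-adjacent (Equivalence.to (scale∈arcAt⇔ (pos v) (pos u)) u∈Av) (u≢v ∘ sym))

  arcs-model : IsCAModel G arcs
  arcs-model u v u≢v = mk⇔ adjacent⇒meet (meet⇒adjacent u≢v)

  beyond-arcAt : ∀ p q → p ≢ q → scale p ∈A arcAt q →
    ∃[ y ] offset C (scale q) y ≡ arcLength q × y ∈A arcAt p
  beyond-arcAt p q p≢q p∈q =
    y , qy≡L , subst (_< arcLength p) (sym py≡) (scaledEnd< m 1≤d (reach-step p q d≤reach) dn≤L)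
    where
    d : ℕ
    d = offset m q p
    d≤reach : d ≤ reach q
    d≤reach = Equivalence.to (scale∈arcAt⇔ q p) p∈q
    1≤d : 1 ≤ d
    1≤d = n≢0⇒n>0 λ d≡0 → p≢q (sym (offset≡0⇒≡ {s = q} d≡0))
    1≤m : 1 ≤ m
    1≤m = ≤-trans 1≤d (s≤s⁻¹ (offset< q p))
    qp≡dn : offset C (scale q) (scale p) ≡ d * n
    qp≡dn = offset-scale q p
    dn≤L : d * n ≤ arcLength q
    dn≤L = <⇒≤ (subst (_< arcLength q) qp≡dn p∈q)
    y-beyond : ∃[ y ] offset C (scale q) y ≡ arcLength q
    y-beyond = offset-surjective (scale q) (scaledLength< m 1≤m (reach≤m q))
    y : Fin (suc C)
    y = proj₁ y-beyond
    qy≡L : offset C (scale q) y ≡ arcLength q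
    qy≡L = proj₂ y-beyond
    py≡ : offset C (scale p) y ≡ arcLength q ∸ d * n
    py≡ = begin
      offset C (scale p) y
        ≡⟨ m+n∸m≡n (offset C (scale q) (scale p)) _ ⟨
      offset C (scale q) (scale p) + offset C (scale p) y ∸ offset C (scale q) (scale p)
        ≡⟨ cong₂ _∸_ (offset-+ˡ (scale q) (scale p) y (subst₂ _≤_ (sym qp≡dn) (sym qy≡L) dn≤L)) qp≡dn ⟩
      offset C (scale q) y ∸ d * n
        ≡⟨ cong (_∸ d * n) qy≡L ⟩
      arcLength q ∸ d * n
        ∎
      where open ≡-Reasoning

  arcAt-proper : ∀ p q → ¬ ProperSubArc (arcAt p) (arcAt q)
  arcAt-proper p q (p⊆q , z , z∈q , z∉p) with p ≟ q
  ... | yes refl = z∉p z∈q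
  ... | no p≢q   = let y , qy≡L , y∈p = beyond-arcAt p q p≢q (p⊆q (scale p) (start∈A (arcAt p)))
                   in <-irrefl qy≡L (p⊆q y y∈p)

  row-commonPoint : ∀ i → ∃[ v ] v ∈ₛ Q i → ∃[ x ] ∀ v → v ∈ₛ Q i → x ∈A arcs v
  row-commonPoint i (v₀ , v₀∈Qi) = scale t , λ v v∈Qi →
    Equivalence.from (scale∈arcAt⇔ (pos v) t) (row-reach i {pos v} {t} (≤-last v v∈Qi) st<l)
    where
    s : Fin n
    s = rowStart i
    l : ℕ
    l = rowLength i
    l∸1<l : l ∸ 1 < l
    l∸1<l = ∸-monoʳ-< z<s (≤-<-trans z≤n (Equivalence.to (row⇔ i v₀) v₀∈Qi))
    last : ∃[ t ] offset m s t ≡ l ∸ 1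
    last = offset-surjective s (<-≤-trans l∸1<l (rowLength≤n i))
    t : Fin n
    t = proj₁ last
    st≡ : offset m s t ≡ l ∸ 1
    st≡ = proj₂ last
    st<l : offset m s t < l
    st<l = subst (_< l) (sym st≡) l∸1<l
    ≤-last : ∀ v → v ∈ₛ Q i → offset m s (pos v) ≤ offset m s t
    ≤-last v v∈Qi = subst (offset m s (pos v) ≤_) (sym st≡) (<⇒≤pred (Equivalence.to (row⇔ i v) v∈Qi))

  arcs-helly : IsHellyModel arcs
  arcs-helly S S-nonempty S-meet =
    let i , S⊆Qi = clique⊆row G Q Q-cliqueMatrix (intersecting⇒clique G arcs arcs-model {S} S-meet)
        x , Qi∋x = row-commonPoint i (map₂ (λ {v} → S⊆Qi v) S-nonempty)
    in x , λ v v∈S → Qi∋x v (S⊆Qi v v∈S)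

  circularOnes⇒properHelly : IsProperHellyCA G
  circularOnes⇒properHelly = C , arcs , arcs-model , (λ u v → arcAt-proper (pos u) (pos v)) , arcs-helly

corollary42 : ∀ {n k} (G : SimpleGraph n) (Q : BMatrix k n) →
    IsCliqueMatrix G Q → IsProperHellyCA G ⇔ CircularOnesRows Q
corollary42 {zero} G Q _ = mk⇔ (λ _ → idₚ , λ _ → tt) (λ _ → 0 , (λ ()) , (λ ()) , (λ ()) , λ _ → λ ())
corollary42 {suc m} G Q Q-cliqueMatrix = mk⇔
  (λ (_ , A , A-model , A-proper , A-helly) → properHelly⇒circularOnes G Q Q-cliqueMatrix A A-model A-proper A-helly)
  (λ (π , Q-circular) → circularOnes⇒properHelly G Q Q-cliqueMatrix π Q-circular)
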